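{- Let $\mathcal D$ be a database schema, $\mathcal U$ a domain and $\mathcal N=\{1,\dots,n\}$. An aggregation procedure $F:\mathcal D(\mathcal U)^n\to\mathcal D(\mathcal U)$ satisfies anonymity, independence and monotonicity if and only if it is a quota rule.
   Context: A database schema $\mathcal D$ is a finite set of relation symbols, each with an arity. Fix a countable domain $\mathcal U$. A $\mathcal D$-instance is a map $D$ assigning to each $P\in\mathcal D$ of arity $q$ a finite relation $D(P)\subseteq\mathcal U^q$; $\mathcal D(\mathcal U)$ is the set of all instances. A profile is $\vec D=(D_1,\dots,D_n)$; $N^{\vec D(P)}_{\vec u}=\{i\in\mathcal N:\vec u\in D_i(P)\}$. Anonymity: for every permutation $\pi$ of $\mathcal N$, $F(D_1,\dots,D_n)=F(D_{\pi(1)},\dots,D_{\pi(n)})$. Independence: for all $P$, profiles $\vec D,\vec D'$ and tuples $\vec u$, if $N^{\vec D(P)}_{\vec u}=N^{\vec D'(P)}_{\vec u}$ then $\vec u\in F(\vec D)(P)$ iff $\vec u\in F(\vec D')(P)$. Monotonicity: for all $P$, $\vec D,\vec D'$, $\vec u$, if $\vec u\in F(\vec D)(P)$ and for every $i\in\mathcal N$ either $D_i(P)=D'_i(P)$ or $D_i(P)\cup\{\vec u\}\subseteq D'_i(P)$, then $\vec u\in F(\vec D')(P)$. A quota rule is given by functions $q_P:\mathcal U^q\to\{0,1,\dots,n+1\}$ for each $P\in\mathcal D$ of arity $q$, with $\vec u\in F(\vec D)(P)$ iff $|N^{\vec D(P)}_{\vec u}|\ge q_P(\vec u)$. -}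

module Defs where

open import Data.Nat as ℕ using (ℕ; _≤_)
open import Data.Fin using (Fin; toℕ)
open import Data.Fin.Subset using (Subset; ∣_∣)
open import Data.Fin.Permutation using (Permutation′; _⟨$⟩ʳ_)
open import Data.Vec using (Vec; tabulate)
open import Data.Bool using (Bool)
open import Data.List using (List)
open import Data.List.Membership.Propositional using (_∈_)
import Data.List.Membership.DecPropositional as DecMem
open import Data.Vec.Properties using (≡-dec)
open import Data.List.Relation.Binary.Subset.Propositional using (_⊆_)
open import Data.Product using (_×_; Σ)
open import Data.Sum using (_⊎_)
open import Function.Bundles using (_↣_; _⇔_; Injection)
open import Relation.Nullary using (does; yes; no)
open import Relation.Binary.Definitions using (DecidableEquality)
open import Relation.Binary.PropositionalEquality using (_≡_; cong)

record Schema : Set where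
  field
    m     : ℕ
    arity : Fin m → ℕ
open Schema public

record Domain : Set₁ where
  field
    U   : Set
    enc : U ↣ ℕ
open Domain public

_≟U_ : (𝒰 : Domain) → DecidableEquality (U 𝒰)
(𝒰 ≟U x) y with Injection.to (enc 𝒰) x ℕ.≟ Injection.to (enc 𝒰) y
... | yes p = yes (Injection.injective (enc 𝒰) p)
... | no ¬p = no (λ e → ¬p (cong (Injection.to (enc 𝒰)) e))

Tuple : Domain → ℕ → Set
Tuple 𝒰 q = Vec (U 𝒰) q

-- A finite relation of arity q is represented by a finite list of tuples
-- (read as the set of its members).
Rel : Domain → ℕ → Set
Rel 𝒰 q = List (Tuple 𝒰 q)

Instance : Schema → Domain → Set
Instance 𝒟 𝒰 = (P : Fin (m 𝒟)) → Rel 𝒰 (arity 𝒟 P)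

_≈I_ : {𝒟 : Schema} {𝒰 : Domain} → Instance 𝒟 𝒰 → Instance 𝒟 𝒰 → Set
_≈I_ {𝒟} D D' = ∀ (P : Fin (m 𝒟)) u → (u ∈ D P) ⇔ (u ∈ D' P)

_≐_ : {𝒰 : Domain} {q : ℕ} → Rel 𝒰 q → Rel 𝒰 q → Set
R ≐ R' = ∀ u → (u ∈ R) ⇔ (u ∈ R')

Profile : Schema → Domain → ℕ → Set
Profile 𝒟 𝒰 n = Fin n → Instance 𝒟 𝒰

Aggregator : Schema → Domain → ℕ → Set
Aggregator 𝒟 𝒰 n = Profile 𝒟 𝒰 n → Instance 𝒟 𝒰

module _ (𝒟 : Schema) (𝒰 : Domain) (n : ℕ) where

  coalition : Profile 𝒟 𝒰 n → (P : Fin (m 𝒟)) → Tuple 𝒰 (arity 𝒟 P) → Subset n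
  coalition D P u = tabulate (λ i → does (DecMem._∈?_ (≡-dec (_≟U_ 𝒰)) u (D i P)))

  Anonymous : Aggregator 𝒟 𝒰 n → Set
  Anonymous F = ∀ (π : Permutation′ n) (D : Profile 𝒟 𝒰 n) →
    _≈I_ {𝒟} {𝒰} (F D) (F (λ i → D (π ⟨$⟩ʳ i)))

  Independent : Aggregator 𝒟 𝒰 n → Set
  Independent F = ∀ (P : Fin (m 𝒟)) (D D' : Profile 𝒟 𝒰 n) u →
    (∀ i → (u ∈ D i P) ⇔ (u ∈ D' i P)) →
    (u ∈ F D P) ⇔ (u ∈ F D' P)

  Monotonic : Aggregator 𝒟 𝒰 n → Set
  Monotonic F = ∀ (P : Fin (m 𝒟)) (D D' : Profile 𝒟 𝒰 n) u →
    u ∈ F D P →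
    (∀ i → (_≐_ {𝒰} (D i P) (D' i P)) ⊎ ((u ∈ D' i P) × (D i P ⊆ D' i P))) →
    u ∈ F D' P

  IsQuotaRule : Aggregator 𝒟 𝒰 n → Set
  IsQuotaRule F = Σ ((P : Fin (m 𝒟)) → Tuple 𝒰 (arity 𝒟 P) → Fin (ℕ.suc (ℕ.suc n)))
    λ q → ∀ (D : Profile 𝒟 𝒰 n) (P : Fin (m 𝒟)) u →
      (u ∈ F D P) ⇔ (toℕ (q P u) ≤ ∣ coalition D P u ∣)

module Submission where

-- The heart of the proof is a purely combinatorial fact about properties A
-- of Boolean vectors c : Fin n → Bool ("coalitions").  If A is decidable,
-- invariant under permuting the agents and closed upwards, then A holds of
-- c exactly when the number of true entries of c reaches a fixed quota.
-- Indeed every c can be permuted into the threshold vector 1…10…0 with the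
-- same number of ones, so A only depends on that number, and an upward
-- closed decidable property of numbers 0…n is a threshold q ∈ {0,…,n+1}.
--
-- For the database theorem, fix a symbol P and a tuple u.  Independence
-- lets us replace any profile by the "witness profile" in which agent i
-- holds just {u} at P when i belongs to the coalition; the three axioms
-- then make "u ∈ F(witness c)(P)" a property of c as above, which yields
-- the quota q_P(u).  Conversely, a quota rule only looks at the size of
-- the coalition, which is permutation invariant, determined by the
-- coalition, and monotone in it.

open import Defs
open import Data.Nat as ℕ using (ℕ; zero; suc; _≤_; _<ᵇ_; z≤n; s≤s)
open import Data.Nat.Properties using (≤-trans; ≤-reflexive; <ᵇ⇒<; <⇒<ᵇ; +-0-commutativeMonoid)
open import Data.Fin as Fin using (Fin; zero; suc; toℕ; fromℕ<)
open import Data.Fin.Properties using (toℕ-fromℕ<; toℕ-injective)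
open import Data.Fin.Subset using (∣_∣)
import Data.Fin.Subset as Subset
open import Data.Fin.Subset.Properties using (∣p∣≤n; p⊆q⇒∣p∣≤∣q∣)
open import Data.Fin.Permutation using (Permutation′; _⟨$⟩ʳ_; _⟨$⟩ˡ_; lift₀; transpose; _∘ₚ_; flip; inverseʳ)
import Data.Fin.Permutation as Perm
import Data.Fin.Permutation.Components as PC
open import Data.Vec using (tabulate)
open import Data.Vec.Properties using (≡-dec; lookup∘tabulate; tabulate-cong; []=⇒lookup; lookup⇒[]=)
open import Data.List using ([]; _∷_)
open import Data.List.Membership.Propositional using (_∈_)
import Data.List.Membership.DecPropositional as DecMembership
open import Data.List.Relation.Unary.Any using (here)
open import Data.Bool using (Bool; true; false; T; if_then_else_)
open import Data.Bool.Properties using (T-≡)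
open import Data.Empty using (⊥-elim)
open import Data.Product using (_×_; Σ; _,_; proj₁; proj₂)
open import Data.Sum using (_⊎_; inj₁; inj₂)
open import Function.Base using (_∘_)
open import Function.Bundles using (_⇔_; mk⇔; Equivalence)
open import Relation.Nullary using (Dec; yes; no; does)
open import Relation.Nullary.Decidable using (does-⇔)
open import Relation.Binary.PropositionalEquality
open import Algebra.Properties.CommutativeMonoid.Sum +-0-commutativeMonoid using (sum; sum-permute)

open Equivalence using (to; from)

Coalition : ℕ → Set
Coalition n = Fin n → Bool

_⊑_ : ∀ {n} → Coalition n → Coalition n → Set
c ⊑ c' = ∀ i → T (c i) → T (c' i)

size : ∀ {n} → Coalition n → ℕ
size c = ∣ tabulate c ∣

∈-tabulate : ∀ {n} (c : Coalition n) {i} → i Subset.∈ tabulate c ⇔ T (c i)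
∈-tabulate c {i} = mk⇔
  (λ i∈c → from T-≡ (trans (sym (lookup∘tabulate c i)) ([]=⇒lookup i∈c)))
  (λ t → lookup⇒[]= i _ (trans (lookup∘tabulate c i) (to T-≡ t)))

size-≤ : ∀ {n} (c : Coalition n) → size c ≤ n
size-≤ c = ∣p∣≤n (tabulate c)

size-cong : ∀ {n} {c c' : Coalition n} → (∀ i → c i ≡ c' i) → size c ≡ size c'
size-cong eq = cong ∣_∣ (tabulate-cong eq)

size-mono : ∀ {n} {c c' : Coalition n} → c ⊑ c' → size c ≤ size c'
size-mono {c = c} {c'} c⊑c' =
  p⊆q⇒∣p∣≤∣q∣ (λ {i} i∈c → from (∈-tabulate c') (c⊑c' i (to (∈-tabulate c) i∈c)))

indicator : Bool → ℕ
indicator true  = 1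
indicator false = 0

-- The size is the sum of the indicator values; this unfolds one agent at a
-- time and makes permutation invariance an instance of sum-permute.
size≡sum : ∀ {n} (c : Coalition n) → size c ≡ sum (indicator ∘ c)
size≡sum {zero} c = refl
size≡sum {suc n} c with c zero
... | true  = cong suc (size≡sum (c ∘ suc))
... | false = size≡sum (c ∘ suc)

size-perm : ∀ {n} (π : Permutation′ n) (c : Coalition n) → size (c ∘ (π ⟨$⟩ʳ_)) ≡ size c
size-perm π c = begin
  size (c ∘ (π ⟨$⟩ʳ_))             ≡⟨ size≡sum (c ∘ (π ⟨$⟩ʳ_)) ⟩
  sum (indicator ∘ c ∘ (π ⟨$⟩ʳ_))   ≡⟨ sum-permute (indicator ∘ c) π ⟨
  sum (indicator ∘ c)               ≡⟨ size≡sum c ⟨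
  size c                           ∎
  where open ≡-Reasoning

threshold : ∀ {n} → ℕ → Coalition n
threshold k i = toℕ i <ᵇ k

threshold-mono : ∀ {n} {k k'} → k ≤ k' → threshold {n} k ⊑ threshold k'
threshold-mono {k = k} k≤k' i t = <⇒<ᵇ (≤-trans (<ᵇ⇒< (toℕ i) k t) k≤k')

<ᵇ-irrefl : ∀ a → (a <ᵇ a) ≡ false
<ᵇ-irrefl zero    = refl
<ᵇ-irrefl (suc a) = <ᵇ-irrefl a

<ᵇ-suc : ∀ a → (a <ᵇ suc a) ≡ true
<ᵇ-suc zero    = refl
<ᵇ-suc (suc a) = <ᵇ-suc a

<ᵇ-suc-≢ : ∀ a b → a ≢ b → (a <ᵇ suc b) ≡ (a <ᵇ b)
<ᵇ-suc-≢ zero    zero    a≢b = ⊥-elim (a≢b refl)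
<ᵇ-suc-≢ zero    (suc b) a≢b = refl
<ᵇ-suc-≢ (suc a) zero    a≢b = refl
<ᵇ-suc-≢ (suc a) (suc b) a≢b = <ᵇ-suc-≢ a b (a≢b ∘ cong suc)

swap-into-threshold : ∀ {n} (K : Fin (suc n)) (v : Coalition (suc n)) →
  v zero ≡ false → (∀ j → v (suc j) ≡ threshold (toℕ K) j) →
  ∀ i → v (PC.transpose zero K i) ≡ threshold (toℕ K) i
swap-into-threshold zero    v v₀ vₛ zero    = v₀
swap-into-threshold (suc K) v v₀ vₛ zero    = trans (vₛ K) (<ᵇ-suc (toℕ K))
swap-into-threshold zero    v v₀ vₛ (suc j) = vₛ j
swap-into-threshold (suc K) v v₀ vₛ (suc j) with j Fin.≟ K
... | yes refl = trans v₀ (sym (<ᵇ-irrefl (toℕ j)))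
... | no j≢K   = trans (vₛ j) (<ᵇ-suc-≢ (toℕ j) (toℕ K) (j≢K ∘ toℕ-injective))

-- By induction on n, sorting agents 1…n first; an absent
-- agent 0 is then swapped behind the present ones.  Once c zero is fixed,
-- size c unfolds definitionally to (1 +) size (c ∘ suc).
sort : ∀ {n} (c : Coalition n) →
  Σ (Permutation′ n) λ π → ∀ i → c (π ⟨$⟩ʳ i) ≡ threshold (size c) i
sort {zero} c = Perm.id , λ ()
sort {suc n} c with sort (c ∘ suc)
... | π , sorted with c zero in c₀
... | true  = lift₀ π , λ { zero → c₀ ; (suc j) → sorted j }
... | false = transpose zero K ∘ₚ lift₀ π , λ i →
    subst (λ k → c (lift₀ π ⟨$⟩ʳ PC.transpose zero K i) ≡ threshold k i) size-K
      (swap-into-threshold K (c ∘ (lift₀ π ⟨$⟩ʳ_)) c₀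
        (λ j → subst (λ k → c (suc (π ⟨$⟩ʳ j)) ≡ threshold k j) (sym size-K) (sorted j)) i)
  where
  K : Fin (suc n)
  K = fromℕ< (s≤s (size-≤ (c ∘ suc)))
  size-K : toℕ K ≡ size (c ∘ suc)
  size-K = toℕ-fromℕ< (s≤s (size-≤ (c ∘ suc)))

upward-threshold : ∀ n (B : ℕ → Set) → (∀ k → Dec (B k)) → (∀ {k k'} → k ≤ k' → B k → B k') →
  Σ (Fin (suc (suc n))) λ q → ∀ k → k ≤ n → B k ⇔ (toℕ q ≤ k)
upward-threshold n B B? up with B? 0
... | yes b₀ = zero , λ k _ → mk⇔ (λ _ → z≤n) (λ _ → up z≤n b₀)
upward-threshold zero B B? up | no ¬b₀ =
  suc zero , λ { zero _ → mk⇔ (⊥-elim ∘ ¬b₀) (λ ()) }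
upward-threshold (suc n) B B? up | no ¬b₀
  with upward-threshold n (B ∘ suc) (B? ∘ suc) (up ∘ s≤s)
... | q , B⇔q = suc q , λ
  { zero _          → mk⇔ (⊥-elim ∘ ¬b₀) (λ ())
  ; (suc k) (s≤s k≤n) → mk⇔ (s≤s ∘ to (B⇔q k k≤n)) (λ { (s≤s q≤k) → from (B⇔q k k≤n) q≤k }) }

symmetric-monotone⇒quota : ∀ n (A : Coalition n → Set) → (∀ c → Dec (A c)) →
  (∀ (π : Permutation′ n) c → A c → A (c ∘ (π ⟨$⟩ʳ_))) →
  (∀ {c c'} → c ⊑ c' → A c → A c') →
  Σ (Fin (suc (suc n))) λ q → ∀ c → A c ⇔ (toℕ q ≤ size c)
symmetric-monotone⇒quota n A A? perm mono
  with upward-threshold n (A ∘ threshold) (A? ∘ threshold) (mono ∘ threshold-mono)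
... | q , A⇔q = q , λ c → mk⇔
  (to (A⇔q (size c) (size-≤ c)) ∘ to (by-size c))
  (from (by-size c) ∘ from (A⇔q (size c) (size-≤ c)))
  where
  ≗⇒⊑ : ∀ {c c' : Coalition n} → (∀ i → c i ≡ c' i) → c ⊑ c'
  ≗⇒⊑ eq i = subst T (eq i)

  -- A only depends on the size: c and its sorted version are permutations
  -- of each other.
  by-size : ∀ c → A c ⇔ A (threshold (size c))
  by-size c with sort c
  ... | π , sorted = mk⇔
    (mono (≗⇒⊑ sorted) ∘ perm π c)
    (mono (≗⇒⊑ λ i → trans (sym (sorted (π ⟨$⟩ˡ i))) (cong c (inverseʳ π))) ∘ perm (flip π) _)

T-does : ∀ {X : Set} (X? : Dec X) → X ⇔ T (does X?)
T-does (yes x) = mk⇔ _ (λ _ → x)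
T-does (no ¬x) = mk⇔ ¬x (λ ())

module _ {𝒟 : Schema} {𝒰 : Domain} where

  _∈?_ : ∀ {k} (u : Tuple 𝒰 k) (R : Rel 𝒰 k) → Dec (u ∈ R)
  _∈?_ = DecMembership._∈?_ (≡-dec (_≟U_ 𝒰))

  -- The coalition N^{D(P)}_u as a Boolean vector; Defs.coalition is its
  -- tabulation, so |N^{D(P)}_u| is definitionally its size.
  members : ∀ {n} → Profile 𝒟 𝒰 n → (P : Fin (m 𝒟)) → Tuple 𝒰 (arity 𝒟 P) → Coalition n
  members D P u i = does (u ∈? D i P)

  singletonIf : ∀ {k} → Tuple 𝒰 k → Bool → Rel 𝒰 k
  singletonIf u b = if b then u ∷ [] else []

  ∈-singletonIf : ∀ {k} (u : Tuple 𝒰 k) b → u ∈ singletonIf u b ⇔ T b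
  ∈-singletonIf u true  = mk⇔ _ (λ _ → here refl)
  ∈-singletonIf u false = mk⇔ (λ ()) (λ ())

  singletonIf-grows : ∀ {k} (u : Tuple 𝒰 k) {b b'} → (T b → T b') →
    _≐_ {𝒰} (singletonIf u b) (singletonIf u b') ⊎
      (u ∈ singletonIf u b' × (∀ {x} → x ∈ singletonIf u b → x ∈ singletonIf u b'))
  singletonIf-grows u {false} {false} _ = inj₁ λ _ → mk⇔ (λ x → x) (λ x → x)
  singletonIf-grows u {true}  {true}  _ = inj₁ λ _ → mk⇔ (λ x → x) (λ x → x)
  singletonIf-grows u {false} {true}  _ = inj₂ (here refl , λ ())
  singletonIf-grows u {true}  {false} b⇒b' = ⊥-elim (b⇒b' _)

  concentrated : (P : Fin (m 𝒟)) → Rel 𝒰 (arity 𝒟 P) → Instance 𝒟 𝒰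
  concentrated P R P' with P' Fin.≟ P
  ... | yes refl = R
  ... | no _     = []

  concentrated-at : ∀ P R → concentrated P R P ≡ R
  concentrated-at P R with P Fin.≟ P
  ... | yes refl = refl
  ... | no P≢P   = ⊥-elim (P≢P refl)

  witness : ∀ {n} (P : Fin (m 𝒟)) → Tuple 𝒰 (arity 𝒟 P) → Coalition n → Profile 𝒟 𝒰 n
  witness P u c i = concentrated P (singletonIf u (c i))

  ∈-witness : ∀ {n} P u (c : Coalition n) i → u ∈ witness P u c i P ⇔ T (c i)
  ∈-witness P u c i rewrite concentrated-at P (singletonIf u (c i)) = ∈-singletonIf u (c i)

  witness-grows : ∀ {n} P u {c c' : Coalition n} → c ⊑ c' → ∀ i →
    _≐_ {𝒰} (witness P u c i P) (witness P u c' i P) ⊎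
      (u ∈ witness P u c' i P × (∀ {x} → x ∈ witness P u c i P → x ∈ witness P u c' i P))
  witness-grows P u {c} {c'} c⊑c' i
    rewrite concentrated-at P (singletonIf u (c i)) | concentrated-at P (singletonIf u (c' i))
    = singletonIf-grows u (c⊑c' i)

  members-witness : ∀ {n} (D : Profile 𝒟 𝒰 n) P u i →
    u ∈ D i P ⇔ u ∈ witness P u (members D P u) i P
  members-witness D P u i = mk⇔
    (from (∈-witness P u (members D P u) i) ∘ to (T-does (u ∈? D i P)))
    (from (T-does (u ∈? D i P)) ∘ to (∈-witness P u (members D P u) i))

  module _ {n : ℕ} (F : Aggregator 𝒟 𝒰 n) where

    quota-by-size : IsQuotaRule 𝒟 𝒰 n F → ∀ D D' P u →
      size (members D P u) ≤ size (members D' P u) → u ∈ F D P → u ∈ F D' P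
    quota-by-size (_ , F⇔q) D D' P u ≤size u∈FD =
      from (F⇔q D' P u) (≤-trans (to (F⇔q D P u) u∈FD) ≤size)

    quota⇒anonymous : IsQuotaRule 𝒟 𝒰 n F → Anonymous 𝒟 𝒰 n F
    quota⇒anonymous quota π D P u = mk⇔
      (quota-by-size quota D _ P u (≤-reflexive (sym (size-perm π (members D P u)))))
      (quota-by-size quota _ D P u (≤-reflexive (size-perm π (members D P u))))

    quota⇒independent : IsQuotaRule 𝒟 𝒰 n F → Independent 𝒟 𝒰 n F
    quota⇒independent quota P D D' u same = mk⇔
      (quota-by-size quota D D' P u (≤-reflexive same-size))
      (quota-by-size quota D' D P u (≤-reflexive (sym same-size)))
      where
      same-size : size (members D P u) ≡ size (members D' P u)
      same-size = size-cong λ i → does-⇔ (same i) (u ∈? D i P) (u ∈? D' i P)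

    quota⇒monotonic : IsQuotaRule 𝒟 𝒰 n F → Monotonic 𝒟 𝒰 n F
    quota⇒monotonic quota P D D' u u∈FD grows =
      quota-by-size quota D D' P u (size-mono members-grow) u∈FD
      where
      members-grow : members D P u ⊑ members D' P u
      members-grow i with grows i
      ... | inj₁ same      = to (T-does (u ∈? D' i P)) ∘ to (same u) ∘ from (T-does (u ∈? D i P))
      ... | inj₂ (u∈D' , _) = λ _ → to (T-does (u ∈? D' i P)) u∈D'

    -- Conversely, under the axioms "u ∈ F(witness c)(P)" is a symmetric,
    -- monotone, decidable property of c, and by independence it decides
    -- u ∈ F(D)(P) for the coalition c of any profile D.
    axioms⇒quota : Anonymous 𝒟 𝒰 n F → Independent 𝒟 𝒰 n F → Monotonic 𝒟 𝒰 n F →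
      IsQuotaRule 𝒟 𝒰 n F
    axioms⇒quota anonymous independent monotonic = (λ P u → proj₁ (quota P u)) , λ D P u →
      let reduce = independent P D (witness P u (members D P u)) u (members-witness D P u)
      in mk⇔ (to (proj₂ (quota P u) (members D P u)) ∘ to reduce)
             (from reduce ∘ from (proj₂ (quota P u) (members D P u)))
      where
      quota : ∀ P u → Σ (Fin (suc (suc n))) λ q →
        ∀ c → u ∈ F (witness P u c) P ⇔ (toℕ q ≤ size c)
      quota P u = symmetric-monotone⇒quota n (λ c → u ∈ F (witness P u c) P)
        (λ c → u ∈? F (witness P u c) P)
        (λ π c → to (anonymous π (witness P u c) P u))
        (λ c⊑c' u∈F → monotonic P _ _ u u∈F (witness-grows P u c⊑c'))

lemma1 : (𝒟 : Schema) (𝒰 : Domain) (n : ℕ) (F : Aggregator 𝒟 𝒰 n) →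
    (Anonymous 𝒟 𝒰 n F × Independent 𝒟 𝒰 n F × Monotonic 𝒟 𝒰 n F) ⇔
      IsQuotaRule 𝒟 𝒰 n F
lemma1 𝒟 𝒰 n F = mk⇔
  (λ (anonymous , independent , monotonic) → axioms⇒quota F anonymous independent monotonic)
  (λ quota → quota⇒anonymous F quota , quota⇒independent F quota , quota⇒monotonic F quota)
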